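{- Let $1\le \ell\le k-1$ and let $j$ be an integer with $\ell+1-k\le j\le k$. Let $H=(V,E)$ be an $n$-vertex $k$-graph with $V=X\cup Y$, $X\cap Y=\emptyset$, and \[ E=\left\{e\in \binom Vk : |e\cap X| \notin \{j, j+1,\dots, j+k-\ell-1\}\right\}. \] Let $a'=\lfloor k/(k-\ell)\rfloor$ and $a=\lceil k/(k-\ell)\rceil$. If \[ \frac{j-1}{a'(k-\ell)}\,n < |X| < \frac{j+k-\ell}{a(k-\ell)}\,n, \] then $H$ does not contain a Hamilton $\ell$-cycle.
   Context: A $k$-uniform hypergraph ($k$-graph) consists of a vertex set $V$ and an edge set $E\subseteq\binom{V}{k}$. For $1\le \ell\le k-1$, a $k$-graph is an $\ell$-cycle if its vertices can be ordered cyclically so that each edge consists of $k$ consecutive vertices and every two consecutive edges (in the natural order of the edges) share exactly $\ell$ vertices. A Hamilton $\ell$-cycle of $H$ is a spanning subhypergraph of $H$ that is an $\ell$-cycle. -}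

module Defs where

open import Data.Nat using (ℕ; zero; suc; _+_; _*_; _∸_; _/_; _<_; _≤_)
open import Data.Nat.DivMod using (_mod_)
open import Data.Integer as ℤ using (ℤ; +_)
open import Data.Fin using (Fin)
open import Data.Fin.Subset using (Subset; ⊥; ⁅_⁆; _∪_; _∩_; ∣_∣)
open import Data.Fin.Permutation using (Permutation′; _⟨$⟩ʳ_)
open import Data.List using (List; foldr; upTo)
open import Data.Product using (Σ; _×_)
open import Relation.Binary.PropositionalEquality using (_≡_)
open import Relation.Nullary using (¬_)

-- floor and ceiling of m / d, for d ≥ 1 (value at d = 0 is irrelevant junk)
⌊_/_⌋ : ℕ → ℕ → ℕ
⌊ m / zero ⌋ = zero
⌊ m / suc d ⌋ = m / suc d

⌈_/_⌉ : ℕ → ℕ → ℕ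
⌈ m / zero ⌉ = zero
⌈ m / suc d ⌉ = (m + d) / suc d

fromList : ∀ {n} → List (Fin n) → Subset n
fromList = foldr (λ v S → ⁅ v ⁆ ∪ S) ⊥

segment : ∀ n → Permutation′ n → (s k : ℕ) → Subset n
segment zero    σ s k = ⊥
segment (suc m) σ s k =
  fromList (Data.List.map (λ p → σ ⟨$⟩ʳ ((s + p) mod suc m)) (upTo k))

IsEdge : (n k ℓ : ℕ) (j : ℤ) (X : Subset n) → Subset n → Set
IsEdge n k ℓ j X e =
  (∣ e ∣ ≡ k) ×
  ¬ ((j ℤ.≤ + ∣ e ∩ X ∣) × (+ ∣ e ∩ X ∣ ℤ.≤ j ℤ.+ + k ℤ.- + ℓ ℤ.- ℤ.1ℤ))

-- A Hamilton ℓ-cycle in the k-graph on Fin n with edge predicate E: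
-- a cyclic ordering σ of all n vertices and a number t of edges with
-- t (k - ℓ) = n, such that the i-th edge e_i = {σ(i(k-ℓ)), …, σ(i(k-ℓ)+k-1)}
-- (i < t) is an edge of H, and consecutive edges e_i, e_{i+1} (where
-- e_t = e_0, since t(k-ℓ) = n) share exactly ℓ vertices.
HamiltonCycle : (n k ℓ : ℕ) → (Subset n → Set) → Set
HamiltonCycle n k ℓ E =
  Σ (Permutation′ n) λ σ → Σ ℕ λ t →
    (t * (k ∸ ℓ) ≡ n) ×
    (∀ i → i < t →
      E (segment n σ (i * (k ∸ ℓ)) k) ×
      (∣ segment n σ (i * (k ∸ ℓ)) k ∩ segment n σ (suc i * (k ∸ ℓ)) k ∣ ≡ ℓ))

-- Let the Hamilton ℓ-cycle have t edges and put D = k − ℓ, so n = tD and the i-th edge is the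
-- window of k consecutive places starting at place iD of the cyclic order; let c_i be the number
-- of its vertices in X. Moving a window by D places changes its count by at most D, while no c_i
-- lies in the interval {j, …, j + D − 1} of length D, so either every c_i ≤ j − 1 or every
-- c_i ≥ j + D. Since ⌊k/D⌋D ≤ k ≤ ⌈k/D⌉D and the windows of length aD at the places iD cover
-- every place exactly a times, ⌊k/D⌋|X| ≤ Σ c_i ≤ ⌈k/D⌉|X|. After multiplying by D, the first
-- case contradicts the lower bound on |X| and the second the upper bound.

module Submission where

open import Defs
open import Function using (_∘_)
open import Data.Bool using (true; false; if_then_else_)
open import Data.Nat using (ℕ; zero; suc; _+_; _*_; _∸_; _≤_; _<_; z≤n; z<s; s<s; NonZero)
open import Data.Nat.Properties
open import Data.Nat.DivMod using (_%_; _/_; _mod_; m≡m%n+[m/n]*n; m%n<n; m/n*n≤m; [m+n]%n≡m%n; m<n⇒m%n≡m)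
open import Data.Nat.Divisibility using (_∣_; divides; ∣⇒≤)
open import Data.Nat.ListAction using (sum)
open import Algebra.Properties.CommutativeSemigroup +-commutativeSemigroup using (interchange; x∙yz≈y∙xz)
import Algebra.Properties.CommutativeSemigroup *-commutativeSemigroup as *-CS
open import Data.Integer as ℤ using (ℤ; -[1+_]; +≤+; -≤+)
import Data.Integer.Properties as ℤP
import Data.Integer.Tactic.RingSolver as ℤ-Solver
open import Data.Fin using (Fin; toℕ)
import Data.Fin.Properties as FinP
open import Data.Fin.Subset using (Subset; ∣_∣; ⁅_⁆; _∪_; _∩_; _∈_; _∉_; ⊤)
import Data.Fin.Subset.Properties as SubsetP
open import Data.Fin.Permutation using (Permutation′; _⟨$⟩ʳ_; _⟨$⟩ˡ_; inverseʳ; inverseˡ)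
open import Data.List using (List; []; _∷_; map; applyUpTo)
open import Data.List.Properties using (map-upTo; map-applyUpTo)
import Data.List.Relation.Unary.Any as Any
import Data.List.Relation.Unary.All as All
open import Data.List.Relation.Unary.AllPairs using ([]; _∷_)
open import Data.List.Relation.Unary.Unique.Propositional using (Unique)
import Data.List.Relation.Unary.Unique.Propositional.Properties as UniqueP
open import Data.List.Membership.Propositional using () renaming (_∈_ to _∈ₗ_)
open import Data.List.Membership.Propositional.Properties using (∈-applyUpTo⁺)
open import Data.Vec using ([]; _∷_; lookup; here)
open import Data.Product using (_×_; _,_; proj₁; proj₂)
open import Data.Sum using (_⊎_; inj₁; inj₂; [_,_]′; swap)
open import Relation.Nullary using (¬_; yes; no; contradiction)
open import Relation.Binary.PropositionalEquality

∑ : ℕ → (ℕ → ℕ) → ℕ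
∑ n f = sum (applyUpTo f n)

syntax ∑ n (λ i → e) = ∑[ i < n ] e

∑-cong : ∀ n {f g : ℕ → ℕ} → (∀ i → f i ≡ g i) → ∑ n f ≡ ∑ n g
∑-cong zero    _  = refl
∑-cong (suc n) eq = cong₂ _+_ (eq 0) (∑-cong n (eq ∘ suc))

∑-mono-≤ : ∀ n {f g : ℕ → ℕ} → (∀ i → f i ≤ g i) → ∑ n f ≤ ∑ n g
∑-mono-≤ zero    _  = z≤n
∑-mono-≤ (suc n) le = +-mono-≤ (le 0) (∑-mono-≤ n (le ∘ suc))

∑-zero : ∀ n → ∑[ i < n ] 0 ≡ 0
∑-zero zero    = refl
∑-zero (suc n) = ∑-zero n

∑-distrib-+ : ∀ n (f g : ℕ → ℕ) → ∑[ i < n ] (f i + g i) ≡ ∑ n f + ∑ n g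
∑-distrib-+ zero    f g = refl
∑-distrib-+ (suc n) f g = trans (cong (f 0 + g 0 +_) (∑-distrib-+ n (f ∘ suc) (g ∘ suc)))
                                (interchange (f 0) (g 0) _ _)

∑-+ : ∀ m n (f : ℕ → ℕ) → ∑ (m + n) f ≡ ∑ m f + ∑[ i < n ] f (m + i)
∑-+ zero    n f = refl
∑-+ (suc m) n f = trans (cong (f 0 +_) (∑-+ m n (f ∘ suc))) (sym (+-assoc (f 0) _ _))

∑-suc : ∀ n (f : ℕ → ℕ) → ∑ (suc n) f ≡ ∑ n f + f n
∑-suc zero    f = +-identityʳ (f 0)
∑-suc (suc n) f = trans (cong (f 0 +_) (∑-suc n (f ∘ suc))) (sym (+-assoc (f 0) _ _))

∑-rotate : ∀ n (f : ℕ → ℕ) → f n ≡ f 0 → ∑[ i < n ] f (suc i) ≡ ∑ n f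
∑-rotate n f fn≡f0 = +-cancelˡ-≡ (f 0) _ _ (begin
  ∑ (suc n) f   ≡⟨ ∑-suc n f ⟩
  ∑ n f + f n   ≡⟨ cong (∑ n f +_) fn≡f0 ⟩
  ∑ n f + f 0   ≡⟨ +-comm (∑ n f) (f 0) ⟩
  f 0 + ∑ n f   ∎)
  where open ≡-Reasoning

∑-periodic : ∀ n (f : ℕ → ℕ) → (∀ i → f (i + n) ≡ f i) → ∀ w → ∑[ i < n ] f (w + i) ≡ ∑ n f
∑-periodic n f periodic zero    = refl
∑-periodic n f periodic (suc w) = begin
  ∑[ i < n ] f (suc w + i)   ≡⟨ ∑-cong n (λ i → cong f (sym (+-suc w i))) ⟩
  ∑[ i < n ] f (w + suc i)   ≡⟨ ∑-rotate n (λ i → f (w + i)) wrap ⟩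
  ∑[ i < n ] f (w + i)       ≡⟨ ∑-periodic n f periodic w ⟩
  ∑ n f                      ∎
  where
  open ≡-Reasoning
  wrap : f (w + n) ≡ f (w + 0)
  wrap = trans (periodic w) (cong f (sym (+-identityʳ w)))

∑-prefix-≤ : ∀ {m n} (f : ℕ → ℕ) → m ≤ n → ∑ m f ≤ ∑ n f
∑-prefix-≤ {m} {n} f m≤n = begin
  ∑ m f                                  ≤⟨ m≤m+n (∑ m f) _ ⟩
  ∑ m f + ∑[ i < n ∸ m ] f (m + i)       ≡⟨ ∑-+ m (n ∸ m) f ⟨
  ∑ (m + (n ∸ m)) f                      ≡⟨ cong (λ l → ∑ l f) (m+[n∸m]≡n m≤n) ⟩
  ∑ n f                                  ∎
  where open ≤-Reasoning

∑-≤-* : ∀ n {c} {f : ℕ → ℕ} → (∀ i → i < n → f i ≤ c) → ∑ n f ≤ n * c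
∑-≤-* zero    _  = z≤n
∑-≤-* (suc n) le = +-mono-≤ (le 0 z<s) (∑-≤-* n (λ i i<n → le (suc i) (s<s i<n)))

∑-≥-* : ∀ n {c} {f : ℕ → ℕ} → (∀ i → i < n → c ≤ f i) → n * c ≤ ∑ n f
∑-≥-* zero    _  = z≤n
∑-≥-* (suc n) le = +-mono-≤ (le 0 z<s) (∑-≥-* n (λ i i<n → le (suc i) (s<s i<n)))

module Window (f : ℕ → ℕ) where

  window : ℕ → ℕ → ℕ
  window L s = ∑[ q < L ] f (s + q)

  window-+ : ∀ a b s → window (a + b) s ≡ window a s + window b (a + s)
  window-+ a b s = trans (∑-+ a b (λ q → f (s + q)))
    (cong (window a s +_) (∑-cong b (λ q → cong f (trans (x∙yz≈y∙xz s a q) (sym (+-assoc a s q))))))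

  window-monoˡ-≤ : ∀ {a b} s → a ≤ b → window a s ≤ window b s
  window-monoˡ-≤ s = ∑-prefix-≤ (λ q → f (s + q))

  window-blocks : ∀ D t w → ∑[ i < t ] window D (i * D + w) ≡ window (t * D) w
  window-blocks D zero    w = refl
  window-blocks D (suc t) w = begin
    window D w + ∑[ i < t ] window D ((D + i * D) + w)   ≡⟨ cong (window D w +_) (∑-cong t shift) ⟩
    window D w + ∑[ i < t ] window D (i * D + (D + w))   ≡⟨ cong (window D w +_) (window-blocks D t (D + w)) ⟩
    window D w + window (t * D) (D + w)                  ≡⟨ window-+ D (t * D) w ⟨
    window (D + t * D) w                                 ∎
    where
    open ≡-Reasoning
    shift : ∀ i → window D ((D + i * D) + w) ≡ window D (i * D + (D + w))
    shift i = cong (window D) (trans (+-assoc D (i * D) w) (x∙yz≈y∙xz D (i * D) w))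

  module _ (t D : ℕ) (periodic : ∀ p → f (p + t * D) ≡ f p) where

    window-tiling : ∀ m w → ∑[ i < t ] window (m * D) (i * D + w) ≡ m * ∑ (t * D) f
    window-tiling zero    w = ∑-zero t
    window-tiling (suc m) w = begin
      ∑[ i < t ] window (D + m * D) (i * D + w)
        ≡⟨ ∑-cong t (λ i → window-+ D (m * D) (i * D + w)) ⟩
      ∑[ i < t ] (window D (i * D + w) + window (m * D) (D + (i * D + w)))
        ≡⟨ ∑-distrib-+ t _ _ ⟩
      ∑[ i < t ] window D (i * D + w) + ∑[ i < t ] window (m * D) (D + (i * D + w))
        ≡⟨ cong₂ _+_ (window-blocks D t w) (∑-cong t shift) ⟩
      window (t * D) w + ∑[ i < t ] window (m * D) (i * D + (D + w))
        ≡⟨ cong₂ _+_ (∑-periodic (t * D) f periodic w) (window-tiling m (D + w)) ⟩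
      ∑ (t * D) f + m * ∑ (t * D) f
        ∎
      where
      open ≡-Reasoning
      shift : ∀ i → window (m * D) (D + (i * D + w)) ≡ window (m * D) (i * D + (D + w))
      shift i = cong (window (m * D)) (x∙yz≈y∙xz D (i * D) w)

    ∑-windows-≥ : ∀ a {k} → a * D ≤ k → a * ∑ (t * D) f ≤ ∑[ i < t ] window k (i * D)
    ∑-windows-≥ a {k} aD≤k = begin
      a * ∑ (t * D) f                      ≡⟨ window-tiling a 0 ⟨
      ∑[ i < t ] window (a * D) (i * D + 0) ≤⟨ ∑-mono-≤ t (λ i → window-monoˡ-≤ _ aD≤k) ⟩
      ∑[ i < t ] window k (i * D + 0)       ≡⟨ ∑-cong t (λ i → cong (window k) (+-identityʳ (i * D))) ⟩
      ∑[ i < t ] window k (i * D)           ∎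
      where open ≤-Reasoning

    ∑-windows-≤ : ∀ a {k} → k ≤ a * D → ∑[ i < t ] window k (i * D) ≤ a * ∑ (t * D) f
    ∑-windows-≤ a {k} k≤aD = begin
      ∑[ i < t ] window k (i * D)           ≡⟨ ∑-cong t (λ i → cong (window k) (+-identityʳ (i * D))) ⟨
      ∑[ i < t ] window k (i * D + 0)       ≤⟨ ∑-mono-≤ t (λ i → window-monoˡ-≤ _ k≤aD) ⟩
      ∑[ i < t ] window (a * D) (i * D + 0) ≡⟨ window-tiling a 0 ⟩
      a * ∑ (t * D) f                       ∎
      where open ≤-Reasoning

  module _ (f≤1 : ∀ p → f p ≤ 1) where

    window-≤-length : ∀ L s → window L s ≤ L
    window-≤-length L s = subst (window L s ≤_) (*-identityʳ L) (∑-≤-* L (λ q _ → f≤1 (s + q)))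

    window-shift-≤ : ∀ k D s → window k (D + s) ≤ window k s + D
    window-shift-≤ k D s = begin
      window k (D + s)                ≤⟨ m≤n+m _ (window D s) ⟩
      window D s + window k (D + s)   ≡⟨ window-+ D k s ⟨
      window (D + k) s                ≡⟨ cong (λ L → window L s) (+-comm D k) ⟩
      window (k + D) s                ≡⟨ window-+ k D s ⟩
      window k s + window D (k + s)   ≤⟨ +-monoʳ-≤ (window k s) (window-≤-length D (k + s)) ⟩
      window k s + D                  ∎
      where open ≤-Reasoning

    window-unshift-≤ : ∀ k D s → window k s ≤ window k (D + s) + D
    window-unshift-≤ k D s = begin
      window k s                      ≤⟨ m≤m+n (window k s) _ ⟩
      window k s + window D (k + s)   ≡⟨ window-+ k D s ⟨
      window (k + D) s                ≡⟨ cong (λ L → window L s) (+-comm k D) ⟩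
      window (D + k) s                ≡⟨ window-+ D k s ⟩
      window D s + window k (D + s)   ≤⟨ +-monoˡ-≤ (window k (D + s)) (window-≤-length D s) ⟩
      D + window k (D + s)            ≡⟨ +-comm D _ ⟩
      window k (D + s) + D            ∎
      where open ≤-Reasoning

indicator : ∀ {n} → Subset n → Fin n → ℕ
indicator p x = if lookup p x then 1 else 0

indicator-≤1 : ∀ {n} (p : Subset n) x → indicator p x ≤ 1
indicator-≤1 p x with lookup p x
... | true  = ≤-refl
... | false = z≤n

∣[⁅x⁆∪p]∩q∣≡indicator+∣p∩q∣ : ∀ {n} {x : Fin n} {p} q → x ∉ p →
                               ∣ (⁅ x ⁆ ∪ p) ∩ q ∣ ≡ indicator q x + ∣ p ∩ q ∣
∣[⁅x⁆∪p]∩q∣≡indicator+∣p∩q∣ {x = Fin.zero} {true ∷ p} q x∉p = contradiction here x∉p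
∣[⁅x⁆∪p]∩q∣≡indicator+∣p∩q∣ {x = Fin.zero} {false ∷ p} (true ∷ q) _
  rewrite SubsetP.∪-identityˡ p = refl
∣[⁅x⁆∪p]∩q∣≡indicator+∣p∩q∣ {x = Fin.zero} {false ∷ p} (false ∷ q) _
  rewrite SubsetP.∪-identityˡ p = refl
∣[⁅x⁆∪p]∩q∣≡indicator+∣p∩q∣ {x = Fin.suc x} {true ∷ p} (true ∷ q) x∉p =
  trans (cong suc (∣[⁅x⁆∪p]∩q∣≡indicator+∣p∩q∣ q (SubsetP.drop-not-there x∉p))) (sym (+-suc _ _))
∣[⁅x⁆∪p]∩q∣≡indicator+∣p∩q∣ {x = Fin.suc x} {true ∷ p} (false ∷ q) x∉p =
  ∣[⁅x⁆∪p]∩q∣≡indicator+∣p∩q∣ q (SubsetP.drop-not-there x∉p)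
∣[⁅x⁆∪p]∩q∣≡indicator+∣p∩q∣ {x = Fin.suc x} {false ∷ p} (_ ∷ q) x∉p =
  ∣[⁅x⁆∪p]∩q∣≡indicator+∣p∩q∣ q (SubsetP.drop-not-there x∉p)

∈-fromList⁻ : ∀ {n} {x : Fin n} xs → x ∈ fromList xs → x ∈ₗ xs
∈-fromList⁻ []       x∈ = contradiction x∈ SubsetP.∉⊥
∈-fromList⁻ (y ∷ ys) x∈ =
  [ Any.here ∘ SubsetP.x∈⁅y⁆⇒x≡y y , Any.there ∘ ∈-fromList⁻ ys ]′ (SubsetP.x∈p∪q⁻ ⁅ y ⁆ (fromList ys) x∈)

∈-fromList⁺ : ∀ {n} {x : Fin n} {xs} → x ∈ₗ xs → x ∈ fromList xs
∈-fromList⁺ (Any.here refl) = SubsetP.x∈p∪q⁺ (inj₁ (SubsetP.x∈⁅x⁆ _))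
∈-fromList⁺ (Any.there x∈) = SubsetP.x∈p∪q⁺ (inj₂ (∈-fromList⁺ x∈))

∣fromList∩q∣≡sum : ∀ {n} {xs : List (Fin n)} q → Unique xs →
                   ∣ fromList xs ∩ q ∣ ≡ sum (map (indicator q) xs)
∣fromList∩q∣≡sum {n} q [] = trans (cong ∣_∣ (SubsetP.∩-zeroˡ q)) (SubsetP.∣⊥∣≡0 n)
∣fromList∩q∣≡sum {xs = x ∷ xs} q (x≢xs ∷ unique) =
  trans (∣[⁅x⁆∪p]∩q∣≡indicator+∣p∩q∣ q x∉xs) (cong (indicator q x +_) (∣fromList∩q∣≡sum q unique))
  where
  x∉xs : x ∉ fromList xs
  x∉xs x∈xs = All.lookup x≢xs (∈-fromList⁻ xs x∈xs) refl

[m+d]%n≡m%n⇒d≡0 : ∀ m {d n} .{{_ : NonZero n}} → d < n → (m + d) % n ≡ m % n → d ≡ 0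
[m+d]%n≡m%n⇒d≡0 m {zero}      _   _  = refl
[m+d]%n≡m%n⇒d≡0 m {suc d} {n} d<n eq = contradiction (∣⇒≤ n∣1+d) (<⇒≱ d<n)
  where
  A = (m + suc d) / n
  B = m / n
  n∣1+d : n ∣ suc d
  n∣1+d = divides (A ∸ B) (begin
    suc d                                        ≡⟨ m+n∸m≡n m (suc d) ⟨
    m + suc d ∸ m                                ≡⟨ cong₂ _∸_ (m≡m%n+[m/n]*n (m + suc d) n) (m≡m%n+[m/n]*n m n) ⟩
    ((m + suc d) % n + A * n) ∸ (m % n + B * n)  ≡⟨ cong (λ r → (r + A * n) ∸ (m % n + B * n)) eq ⟩
    (m % n + A * n) ∸ (m % n + B * n)            ≡⟨ [m+n]∸[m+o]≡n∸o (m % n) (A * n) (B * n) ⟩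
    A * n ∸ B * n                                ≡⟨ *-distribʳ-∸ n A B ⟨
    (A ∸ B) * n                                  ∎)
    where open ≡-Reasoning

module CyclicOrder {m : ℕ} (σ : Permutation′ (suc m)) (X : Subset (suc m)) where

  position : ℕ → Fin (suc m)
  position p = σ ⟨$⟩ʳ (p mod suc m)

  occupancy : ℕ → ℕ
  occupancy p = indicator X (position p)

  open Window occupancy public

  occupancy-≤1 : ∀ p → occupancy p ≤ 1
  occupancy-≤1 p = indicator-≤1 X (position p)

  occupancy-periodic : ∀ p → occupancy (p + suc m) ≡ occupancy p
  occupancy-periodic p = cong (λ i → indicator X (σ ⟨$⟩ʳ i))
    (FinP.fromℕ<-cong _ _ ([m+n]%n≡m%n p (suc m)) _ _)

  position-injective : ∀ {p q} → position p ≡ position q → p % suc m ≡ q % suc m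
  position-injective {p} {q} eq = begin
    p % suc m          ≡⟨ FinP.toℕ-fromℕ< _ ⟨
    toℕ (p mod suc m)  ≡⟨ cong toℕ mod-eq ⟩
    toℕ (q mod suc m)  ≡⟨ FinP.toℕ-fromℕ< _ ⟩
    q % suc m          ∎
    where
    open ≡-Reasoning
    mod-eq : p mod suc m ≡ q mod suc m
    mod-eq = trans (sym (inverseˡ σ)) (trans (cong (σ ⟨$⟩ˡ_) eq) (inverseˡ σ))

  position-surjective : ∀ v → position (toℕ (σ ⟨$⟩ˡ v)) ≡ v
  position-surjective v = trans (cong (σ ⟨$⟩ʳ_) toℕ-mod) (inverseʳ σ)
    where
    toℕ-mod : toℕ (σ ⟨$⟩ˡ v) mod suc m ≡ σ ⟨$⟩ˡ v
    toℕ-mod = FinP.toℕ-injective (trans (FinP.toℕ-fromℕ< _) (m<n⇒m%n≡m (FinP.toℕ<n _)))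

  positions-distinct : ∀ s {k} → k ≤ suc m → ∀ {p q} → p < q → q < k → position (s + p) ≢ position (s + q)
  positions-distinct s k≤n {p} {q} p<q q<k eq = <⇒≢ (m<n⇒0<n∸m p<q) (sym q∸p≡0)
    where
    q∸p<n : q ∸ p < suc m
    q∸p<n = ≤-<-trans (m∸n≤m q p) (<-≤-trans q<k k≤n)
    q∸p≡0 : q ∸ p ≡ 0
    q∸p≡0 = [m+d]%n≡m%n⇒d≡0 (s + p) q∸p<n (begin
      (s + p + (q ∸ p)) % suc m  ≡⟨ cong (_% suc m) (trans (+-assoc s p (q ∸ p)) (cong (s +_) (m+[n∸m]≡n (<⇒≤ p<q)))) ⟩
      (s + q) % suc m            ≡⟨ position-injective {s + p} {s + q} eq ⟨
      (s + p) % suc m            ∎)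
      where open ≡-Reasoning

  segment≡fromList : ∀ s k → segment (suc m) σ s k ≡ fromList (applyUpTo (λ p → position (s + p)) k)
  segment≡fromList s k = cong fromList (map-upTo _ k)

  ∣segment∩X∣≡window : ∀ s k → k ≤ suc m → ∣ segment (suc m) σ s k ∩ X ∣ ≡ window k s
  ∣segment∩X∣≡window s k k≤n = begin
    ∣ segment (suc m) σ s k ∩ X ∣
      ≡⟨ cong (λ e → ∣ e ∩ X ∣) (segment≡fromList s k) ⟩
    ∣ fromList (applyUpTo (λ p → position (s + p)) k) ∩ X ∣
      ≡⟨ ∣fromList∩q∣≡sum X (UniqueP.applyUpTo⁺₁ _ k (positions-distinct s k≤n)) ⟩
    sum (map (indicator X) (applyUpTo (λ p → position (s + p)) k))
      ≡⟨ cong sum (map-applyUpTo _ (indicator X) k) ⟩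
    window k s
      ∎
    where open ≡-Reasoning

  segment-full : segment (suc m) σ 0 (suc m) ≡ ⊤
  segment-full = SubsetP.⊆-antisym SubsetP.⊆⊤ ⊤⊆segment
    where
    ⊤⊆segment : ∀ {v} → v ∈ ⊤ → v ∈ segment (suc m) σ 0 (suc m)
    ⊤⊆segment {v} _ = subst (v ∈_) (sym (segment≡fromList 0 (suc m)))
      (∈-fromList⁺ (subst (_∈ₗ applyUpTo position (suc m)) (position-surjective v)
        (∈-applyUpTo⁺ position (FinP.toℕ<n (σ ⟨$⟩ˡ v)))))

  ∑-occupancy : ∑ (suc m) occupancy ≡ ∣ X ∣
  ∑-occupancy = begin
    window (suc m) 0                     ≡⟨ ∣segment∩X∣≡window 0 (suc m) ≤-refl ⟨
    ∣ segment (suc m) σ 0 (suc m) ∩ X ∣  ≡⟨ cong (λ e → ∣ e ∩ X ∣) segment-full ⟩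
    ∣ ⊤ ∩ X ∣                            ≡⟨ cong ∣_∣ (SubsetP.∩-identityˡ X) ⟩
    ∣ X ∣                                ∎
    where open ≡-Reasoning

⌊m/n⌋*n≤m : ∀ m n → ⌊ m / n ⌋ * n ≤ m
⌊m/n⌋*n≤m m zero    = z≤n
⌊m/n⌋*n≤m m (suc n) = m/n*n≤m m (suc n)

m≤⌈m/n⌉*n : ∀ m n → 0 < n → m ≤ ⌈ m / n ⌉ * n
m≤⌈m/n⌉*n m (suc d) _ = +-cancelʳ-≤ d m q (begin
  m + d                ≡⟨ m≡m%n+[m/n]*n (m + d) (suc d) ⟩
  (m + d) % suc d + q  ≤⟨ +-monoˡ-≤ q (m<1+n⇒m≤n (m%n<n (m + d) (suc d))) ⟩
  d + q                ≡⟨ +-comm d q ⟩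
  q + d                ∎)
  where
  open ≤-Reasoning
  q = ⌈ m / suc d ⌉ * suc d

module EdgeCounts {m : ℕ} (σ : Permutation′ (suc m)) (X : Subset (suc m)) (k D t : ℕ)
                  (tD≡n : t * D ≡ suc m) where

  open CyclicOrder σ X

  edge-count : ℕ → ℕ
  edge-count i = window k (i * D)

  0<t : 0 < t
  0<t = n≢0⇒n>0 (λ t≡0 → 0≢1+n (trans (cong (_* D) (sym t≡0)) tD≡n))

  ∣edge∩X∣≡edge-count : k ≤ suc m → ∀ i → ∣ segment (suc m) σ (i * D) k ∩ X ∣ ≡ edge-count i
  ∣edge∩X∣≡edge-count k≤n i = ∣segment∩X∣≡window (i * D) k k≤n

  edge-count-suc-≤ : ∀ i → edge-count (suc i) ≤ edge-count i + D
  edge-count-suc-≤ i = window-shift-≤ occupancy-≤1 k D (i * D)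

  edge-count-≤-suc : ∀ i → edge-count i ≤ edge-count (suc i) + D
  edge-count-≤-suc i = window-unshift-≤ occupancy-≤1 k D (i * D)

  private
    periodic : ∀ p → occupancy (p + t * D) ≡ occupancy p
    periodic p = subst (λ N → occupancy (p + N) ≡ occupancy p) (sym tD≡n) (occupancy-periodic p)

    ∑occupancy≡∣X∣ : ∑ (t * D) occupancy ≡ ∣ X ∣
    ∑occupancy≡∣X∣ = trans (cong (λ N → ∑ N occupancy) tD≡n) ∑-occupancy

  ∑-edge-count-≥ : ⌊ k / D ⌋ * ∣ X ∣ ≤ ∑ t edge-count
  ∑-edge-count-≥ = subst (λ x → ⌊ k / D ⌋ * x ≤ ∑ t edge-count) ∑occupancy≡∣X∣
                         (∑-windows-≥ t D periodic ⌊ k / D ⌋ (⌊m/n⌋*n≤m k D))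

  ∑-edge-count-≤ : 0 < D → ∑ t edge-count ≤ ⌈ k / D ⌉ * ∣ X ∣
  ∑-edge-count-≤ 0<D = subst (λ x → ∑ t edge-count ≤ ⌈ k / D ⌉ * x) ∑occupancy≡∣X∣
                             (∑-windows-≤ t D periodic ⌈ k / D ⌉ (m≤⌈m/n⌉*n k D 0<D))

stays-in : ∀ (P Q : ℕ → Set) {t} → (∀ i → P i → ¬ Q (suc i)) → (∀ i → i < t → P i ⊎ Q i) →
           P 0 → ∀ i → i < t → P i
stays-in P Q P↛Q P⊎Q P₀ zero    _     = P₀
stays-in P Q P↛Q P⊎Q P₀ (suc i) 1+i<t with P⊎Q (suc i) 1+i<t
... | inj₁ P₁₊ᵢ = P₁₊ᵢ
... | inj₂ Q₁₊ᵢ = contradiction Q₁₊ᵢ (P↛Q i (stays-in P Q P↛Q P⊎Q P₀ i (<-trans (n<1+n i) 1+i<t)))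

stays-on-one-side : ∀ (P Q : ℕ → Set) t → (∀ i → P i → ¬ Q (suc i)) → (∀ i → Q i → ¬ P (suc i)) →
                    (∀ i → i < t → P i ⊎ Q i) → (∀ i → i < t → P i) ⊎ (∀ i → i < t → Q i)
stays-on-one-side P Q zero    _   _   _   = inj₁ (λ _ ())
stays-on-one-side P Q (suc t) P↛Q Q↛P P⊎Q with P⊎Q 0 z<s
... | inj₁ P₀ = inj₁ (stays-in P Q P↛Q P⊎Q P₀)
... | inj₂ Q₀ = inj₂ (stays-in Q P Q↛P (λ i i<t → swap (P⊎Q i i<t)) Q₀)

open import Data.Integer.Base using (+_)

<⇒≤-1 : ∀ {i j : ℤ} → i ℤ.< j → i ℤ.≤ j ℤ.- ℤ.1ℤ
<⇒≤-1 {i} {j} i<j = subst (i ℤ.≤_) (ℤP.+-comm ℤ.-1ℤ j) (ℤP.i<j⇒i≤pred[j] i<j)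

outside-interval : ∀ {i j M : ℤ} → ¬ (j ℤ.≤ i × i ℤ.≤ M ℤ.- ℤ.1ℤ) → i ℤ.≤ j ℤ.- ℤ.1ℤ ⊎ M ℤ.≤ i
outside-interval {i} {j} {M} i∉[j,M-1] with i ℤP.<? j | M ℤP.≤? i
... | yes i<j | _       = inj₁ (<⇒≤-1 i<j)
... | no _    | yes M≤i = inj₂ M≤i
... | no i≮j  | no M≰i  = contradiction (ℤP.≮⇒≥ i≮j , <⇒≤-1 (ℤP.≰⇒> M≰i)) i∉[j,M-1]

j-1+[k∸ℓ]<j+k-ℓ : ∀ j {k ℓ} → ℓ ≤ k → (j ℤ.- ℤ.1ℤ) ℤ.+ + (k ∸ ℓ) ℤ.< j ℤ.+ + k ℤ.- + ℓ
j-1+[k∸ℓ]<j+k-ℓ j {k} {ℓ} ℓ≤k = ℤP.i≤pred[j]⇒i<j (ℤP.≤-reflexive (begin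
  (j ℤ.- ℤ.1ℤ) ℤ.+ + (k ∸ ℓ)            ≡⟨ cong (ℤ._+_ (j ℤ.- ℤ.1ℤ)) k-ℓ≡k∸ℓ ⟨
  (j ℤ.- ℤ.1ℤ) ℤ.+ (+ k ℤ.- + ℓ)        ≡⟨ shuffle j (+ k) (+ ℓ) ⟩
  ℤ.-1ℤ ℤ.+ (j ℤ.+ + k ℤ.- + ℓ)         ∎))
  where
  open ≡-Reasoning
  k-ℓ≡k∸ℓ : + k ℤ.- + ℓ ≡ + (k ∸ ℓ)
  k-ℓ≡k∸ℓ = trans (ℤP.m-n≡m⊖n k ℓ) (ℤP.⊖-≥ ℓ≤k)
  shuffle : ∀ (j a b : ℤ) → (j ℤ.- ℤ.1ℤ) ℤ.+ (a ℤ.- b) ≡ ℤ.-1ℤ ℤ.+ (j ℤ.+ a ℤ.- b)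
  shuffle = ℤ-Solver.solve-∀

gap-too-wide : ∀ {a b D : ℕ} {L M : ℤ} → L ℤ.+ + D ℤ.< M → + a ℤ.≤ L → M ℤ.≤ + b → a + D < b
gap-too-wide {a} {b} {D} {L} {M} gap a≤L M≤b = ℤP.drop‿+<+ (begin-strict
  + (a + D)    ≡⟨ ℤP.pos-+ a D ⟩
  + a ℤ.+ + D  ≤⟨ ℤP.+-monoˡ-≤ (+ D) a≤L ⟩
  L ℤ.+ + D    <⟨ gap ⟩
  M            ≤⟨ M≤b ⟩
  + b          ∎)
  where open ℤP.≤-Reasoning

bounded-steps-stay-on-one-side : ∀ (c : ℕ → ℕ) t D {L M : ℤ} → L ℤ.+ + D ℤ.< M →
  (∀ i → c (suc i) ≤ c i + D) → (∀ i → c i ≤ c (suc i) + D) →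
  (∀ i → i < t → + c i ℤ.≤ L ⊎ M ℤ.≤ + c i) →
  (∀ i → i < t → + c i ℤ.≤ L) ⊎ (∀ i → i < t → M ℤ.≤ + c i)
bounded-steps-stay-on-one-side c t D {L} {M} gap up down =
  stays-on-one-side (λ i → + c i ℤ.≤ L) (λ i → M ℤ.≤ + c i) t
    (λ i low high → <⇒≱ (gap-too-wide gap low high) (up i))
    (λ i high low → <⇒≱ (gap-too-wide gap low high) (down i))

windows-below⇒density-≤ : ∀ t D a x {l} (c : ℕ → ℕ) → (∀ i → i < t → c i ≤ l) → a * x ≤ ∑ t c →
                          x * (a * D) ≤ l * (t * D)
windows-below⇒density-≤ t D a x {l} c c≤l ax≤∑c = begin
  x * (a * D)  ≡⟨ *-CS.x∙yz≈yx∙z x a D ⟩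
  a * x * D    ≤⟨ *-monoˡ-≤ D (≤-trans ax≤∑c (∑-≤-* t c≤l)) ⟩
  t * l * D    ≡⟨ *-CS.xy∙z≈y∙xz t l D ⟩
  l * (t * D)  ∎
  where open ≤-Reasoning

windows-above⇒density-≥ : ∀ t D a x {l} (c : ℕ → ℕ) → (∀ i → i < t → l ≤ c i) → ∑ t c ≤ a * x →
                          l * (t * D) ≤ x * (a * D)
windows-above⇒density-≥ t D a x {l} c l≤c ∑c≤ax = begin
  l * (t * D)  ≡⟨ *-CS.x∙yz≈yx∙z l t D ⟩
  t * l * D    ≤⟨ *-monoˡ-≤ D (≤-trans (∑-≥-* t l≤c) ∑c≤ax) ⟩
  a * x * D    ≡⟨ *-CS.xy∙z≈y∙xz a x D ⟩
  x * (a * D)  ∎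
  where open ≤-Reasoning

windows-below⇒density-≤ℤ : ∀ {n} t D a x (c : ℕ → ℕ) (L : ℤ) → t * D ≡ n → 0 < t →
                           (∀ i → i < t → + c i ℤ.≤ L) → a * x ≤ ∑ t c →
                           + x ℤ.* + (a * D) ℤ.≤ L ℤ.* + n
windows-below⇒density-≤ℤ {n} t D a x c L tD≡n 0<t c≤L ax≤∑c = begin
  + x ℤ.* + (a * D)  ≡⟨ ℤP.pos-* x (a * D) ⟨
  + (x * (a * D))    ≤⟨ +≤+ (windows-below⇒density-≤ t D a x c c≤l ax≤∑c) ⟩
  + (l * (t * D))    ≡⟨ cong (λ N → + (l * N)) tD≡n ⟩
  + (l * n)          ≡⟨ ℤP.pos-* l n ⟩
  + l ℤ.* + n        ≡⟨ cong (ℤ._* + n) l≡L ⟩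
  L ℤ.* + n          ∎
  where
  open ℤP.≤-Reasoning
  l = ℤ.∣ L ∣
  l≡L : + l ≡ L
  l≡L = ℤP.0≤i⇒+∣i∣≡i (ℤP.≤-trans (+≤+ z≤n) (c≤L 0 0<t))
  c≤l : ∀ i → i < t → c i ≤ l
  c≤l i i<t = ℤP.drop‿+≤+ (subst (+ c i ℤ.≤_) (sym l≡L) (c≤L i i<t))

windows-above⇒density-≥ℤ : ∀ {n} t D a x (c : ℕ → ℕ) (M : ℤ) → t * D ≡ n →
                           (∀ i → i < t → M ℤ.≤ + c i) → ∑ t c ≤ a * x →
                           M ℤ.* + n ℤ.≤ + x ℤ.* + (a * D)
windows-above⇒density-≥ℤ {n} t D a x c (+ l) tD≡n l≤c ∑c≤ax = begin
  + l ℤ.* + n        ≡⟨ ℤP.pos-* l n ⟨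
  + (l * n)          ≡⟨ cong (λ N → + (l * N)) tD≡n ⟨
  + (l * (t * D))    ≤⟨ +≤+ (windows-above⇒density-≥ t D a x c (λ i i<t → ℤP.drop‿+≤+ (l≤c i i<t)) ∑c≤ax) ⟩
  + (x * (a * D))    ≡⟨ ℤP.pos-* x (a * D) ⟩
  + x ℤ.* + (a * D)  ∎
  where open ℤP.≤-Reasoning
windows-above⇒density-≥ℤ {n} _ D a x c -[1+ l ] _ _ _ =
  ℤP.≤-trans (ℤP.*-monoʳ-≤-nonNeg (+ n) (-≤+ {m = l} {n = 0}))
             (subst (+ 0 ℤ.≤_) (ℤP.pos-* x (a * D)) (+≤+ z≤n))

proposition2p2 : (k ℓ : ℕ) → 1 ≤ ℓ → ℓ < k → (j : ℤ) →
    + ℓ ℤ.+ ℤ.1ℤ ℤ.- + k ℤ.≤ j → j ℤ.≤ + k →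
    (n : ℕ) (X : Subset n) →
    (j ℤ.- ℤ.1ℤ) ℤ.* + n ℤ.< + ∣ X ∣ ℤ.* + (⌊ k / k ∸ ℓ ⌋ * (k ∸ ℓ)) →
    + ∣ X ∣ ℤ.* + (⌈ k / k ∸ ℓ ⌉ * (k ∸ ℓ)) ℤ.< (j ℤ.+ + k ℤ.- + ℓ) ℤ.* + n →
    ¬ HamiltonCycle n k ℓ (IsEdge n k ℓ j X)
proposition2p2 _ _ _ _ j _ _ zero [] sparse _ _ = ℤP.<-irrefl (ℤP.*-zeroʳ (j ℤ.- ℤ.1ℤ)) sparse
proposition2p2 k ℓ _ ℓ<k j _ _ (suc m) X sparse dense (σ , t , tD≡n , edges) =
  [ (λ all-low → ℤP.≤⇒≯
      (windows-below⇒density-≤ℤ t D ⌊ k / D ⌋ ∣ X ∣ edge-count L tD≡n 0<t all-low ∑-edge-count-≥) sparse)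
  , (λ all-high → ℤP.≤⇒≯
      (windows-above⇒density-≥ℤ t D ⌈ k / D ⌉ ∣ X ∣ edge-count M tD≡n all-high
        (∑-edge-count-≤ (m<n⇒0<n∸m ℓ<k))) dense)
  ]′ (bounded-steps-stay-on-one-side edge-count t D (j-1+[k∸ℓ]<j+k-ℓ j (<⇒≤ ℓ<k))
        edge-count-suc-≤ edge-count-≤-suc classify)
  where
  D = k ∸ ℓ
  L = j ℤ.- ℤ.1ℤ
  M = j ℤ.+ + k ℤ.- + ℓ
  open EdgeCounts σ X k D t tD≡n
  k≤n : k ≤ suc m
  k≤n = subst (_≤ suc m) (proj₁ (proj₁ (edges 0 0<t))) (SubsetP.∣p∣≤n (segment (suc m) σ 0 k))
  classify : ∀ i → i < t → + edge-count i ℤ.≤ L ⊎ M ℤ.≤ + edge-count i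
  classify i i<t = subst (λ v → + v ℤ.≤ L ⊎ M ℤ.≤ + v) (∣edge∩X∣≡edge-count k≤n i)
                         (outside-interval (proj₂ (proj₁ (edges i i<t))))
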